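{- Let $p\geq 3$ be an integer and let $n_1,m_1\ge 0$ be integers with $m_1\leq 2p$. Then $\mathrm{ex}(n_1,m_1;P_7)\leq pn_1+m_1$, with equality if and only if $n_1=m_1=0$, or $m_1=2p$ and $n_1=2$.
   Context: $P_7$ is the path on $7$ vertices. $\mathrm{ex}(a,b;H)$ is the maximum number of edges in a bipartite graph with parts of sizes $a$ and $b$ containing no subgraph isomorphic to $H$. -}

module Defs where

open import Data.Nat using (ℕ; zero; suc; _+_)
open import Data.Bool using (Bool; true; false)
open import Data.Fin using (Fin; zero; suc; toℕ)
open import Data.Sum using (_⊎_; inj₁; inj₂)
open import Data.Product using (Σ; ∃; _×_)
open import Data.Empty using (⊥)
open import Relation.Binary.PropositionalEquality using (_≡_)
open import Function.Definitions using (Injective)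
open import Relation.Nullary using (¬_)

-- A bipartite graph with parts of sizes a and b: an edge relation between
-- the part A = Fin a and the part B = Fin b (edges only go across parts).
BipGraph : ℕ → ℕ → Set
BipGraph a b = Fin a → Fin b → Bool

Vertex : ℕ → ℕ → Set
Vertex a b = Fin a ⊎ Fin b

Adj : ∀ {a b} → BipGraph a b → Vertex a b → Vertex a b → Set
Adj G (inj₁ x) (inj₂ y) = G x y ≡ true
Adj G (inj₂ y) (inj₁ x) = G x y ≡ true
Adj G (inj₁ _) (inj₁ _) = ⊥
Adj G (inj₂ _) (inj₂ _) = ⊥

sumFin : ∀ {n} → (Fin n → ℕ) → ℕ
sumFin {zero} f = 0
sumFin {suc n} f = f zero + sumFin (λ i → f (suc i))

b2n : Bool → ℕ
b2n true = 1
b2n false = 0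

edges : ∀ {a b} → BipGraph a b → ℕ
edges G = sumFin (λ x → sumFin (λ y → b2n (G x y)))

ContainsPath : ∀ {a b} → ℕ → BipGraph a b → Set
ContainsPath {a} {b} k G =
  Σ (Fin k → Vertex a b) λ f →
    Injective _≡_ _≡_ f × (∀ (i : Fin k) (j : Fin k) → toℕ j ≡ suc (toℕ i) → Adj G (f i) (f j))

P7Free : ∀ {a b} → BipGraph a b → Set
P7Free G = ¬ ContainsPath 7 G

{-# OPTIONS --safe #-}
module Submission where

-- Induction on the numbers of rows and columns: a column of degree at most 1 or a row of degree
-- at most p can be deleted, and with at least three rows the bound is strict. One of the two
-- always exists: otherwise every row has degree ≥ p + 1 ≥ 4 and every column degree ≥ 2, and two
-- rows with a common neighbour lie on a path on five vertices whose end rows extend it to a P₇;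
-- so some two rows have disjoint neighbourhoods and 2p + 2 ≤ m, contradicting m ≤ 2p. With three
-- rows, deleting a row of degree ≤ p keeps the bound strict unless the other two rows are
-- complete and m = 2p; then the deleted row has two neighbours and closes a P₇. Two rows never
-- carry a P₇, since the disjoint edges 01, 23, 45 of a path have three distinct row endpoints;
-- hence K₂,₂ₚ is extremal.

open import Defs
open import Data.Bool using (Bool; true; false)
open import Data.Bool.Properties using () renaming (_≟_ to _≟ᵇ_)
open import Data.Empty using (⊥; ⊥-elim)
open import Data.Fin using (Fin; zero; suc; toℕ; punchIn; inject₁; #_)
open import Data.Fin.Properties using (punchIn-injective; punchInᵢ≢i; any?; pigeonhole; _≟_)
  renaming (<-irrefl to <ᶠ-irrefl)
open import Data.List using (List; []; _∷_; length)
open import Data.List.Membership.Propositional using (_∈_)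
open import Data.List.Relation.Unary.All using (All; []; _∷_)
open import Data.List.Relation.Unary.All.Properties using (¬Any⇒All¬)
open import Data.List.Relation.Unary.Any as Any using (here; there)
open import Data.Nat using (ℕ; zero; suc; _+_; _*_; _≤_; _<_; z≤n; s≤s; z<s; _≤?_; _<?_)
open import Data.Nat.Properties hiding (_≟_)
open import Algebra.Properties.CommutativeSemigroup +-commutativeSemigroup using (interchange; x∙yz≈y∙xz)
open import Data.Nat.Tactic.RingSolver using (solve-∀)
open import Data.Product using (Σ; ∃₂; ∃-syntax; _×_; _,_)
open import Data.Sum using (_⊎_; inj₁; inj₂; [_,_]′)
open import Data.Sum.Properties using (inj₁-injective; inj₂-injective)
open import Data.Vec using (Vec; []; _∷_; lookup)
open import Data.Vec.Relation.Unary.All using ([]; _∷_)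
open import Data.Vec.Relation.Unary.AllPairs using ([]; _∷_)
open import Data.Vec.Relation.Unary.Unique.Propositional using (Unique)
open import Data.Vec.Relation.Unary.Unique.Propositional.Properties using (lookup-injective)
open import Function using (id; _∘_)
open import Function.Bundles using (_⇔_; mk⇔)
open import Function.Definitions using (Injective)
open import Relation.Binary.PropositionalEquality
open import Relation.Nullary using (yes; no; contradiction)
open import Relation.Nullary.Decidable using (_×-dec_; ¬?; decidable-stable)

sumFin-cong : ∀ {n} {f g : Fin n → ℕ} → (∀ i → f i ≡ g i) → sumFin f ≡ sumFin g
sumFin-cong {zero}  f≗g = refl
sumFin-cong {suc n} f≗g = cong₂ _+_ (f≗g zero) (sumFin-cong (f≗g ∘ suc))

sumFin-mono : ∀ {n} {f g : Fin n → ℕ} → (∀ i → f i ≤ g i) → sumFin f ≤ sumFin g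
sumFin-mono {zero}  f≤g = z≤n
sumFin-mono {suc n} f≤g = +-mono-≤ (f≤g zero) (sumFin-mono (f≤g ∘ suc))

sumFin-+ : ∀ {n} (f g : Fin n → ℕ) → sumFin (λ i → f i + g i) ≡ sumFin f + sumFin g
sumFin-+ {zero}  f g = refl
sumFin-+ {suc n} f g = trans (cong (f zero + g zero +_) (sumFin-+ (f ∘ suc) (g ∘ suc)))
                             (interchange (f zero) (g zero) _ _)

sumFin-const : ∀ n k → sumFin {n} (λ _ → k) ≡ n * k
sumFin-const zero    k = refl
sumFin-const (suc n) k = cong (k +_) (sumFin-const n k)

sumFin-punchIn : ∀ {n} (i : Fin (suc n)) (f : Fin (suc n) → ℕ) →
                 sumFin f ≡ f i + sumFin (f ∘ punchIn i)
sumFin-punchIn zero            f = refl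
sumFin-punchIn {suc n} (suc i) f = trans (cong (f zero +_) (sumFin-punchIn i (f ∘ suc)))
                                         (x∙yz≈y∙xz (f zero) (f (suc i)) _)

deg : ∀ {m} → (Fin m → Bool) → ℕ
deg g = sumFin (λ y → b2n (g y))

b2n≤1 : ∀ b → b2n b ≤ 1
b2n≤1 true  = s≤s z≤n
b2n≤1 false = z≤n

deg≤ : ∀ {m} (g : Fin m → Bool) → deg g ≤ m
deg≤ {m} g = begin
  deg g                   ≤⟨ sumFin-mono (b2n≤1 ∘ g) ⟩
  sumFin {m} (λ _ → 1)    ≡⟨ sumFin-const m 1 ⟩
  m * 1                   ≡⟨ *-identityʳ m ⟩
  m                       ∎
  where open ≤-Reasoning

deg-true : ∀ {m} → deg {m} (λ _ → true) ≡ m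
deg-true {m} = trans (sumFin-const m 1) (*-identityʳ m)

deg-punchIn : ∀ {m} (g : Fin (suc m) → Bool) y → deg g ≡ b2n (g y) + deg (g ∘ punchIn y)
deg-punchIn g y = sumFin-punchIn y (b2n ∘ g)

deg-full : ∀ {m} (g : Fin m → Bool) → m ≤ deg g → ∀ y → g y ≡ true
deg-full {suc m} g size≤deg y with g y in gy
... | true  = refl
... | false = ⊥-elim (1+n≰n (begin
  suc m                              ≤⟨ size≤deg ⟩
  deg g                              ≡⟨ deg-punchIn g y ⟩
  b2n (g y) + deg (g ∘ punchIn y)    ≡⟨ cong (λ b → b2n b + deg (g ∘ punchIn y)) gy ⟩
  deg (g ∘ punchIn y)                ≤⟨ deg≤ (g ∘ punchIn y) ⟩
  m                                  ∎))
  where open ≤-Reasoning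

deg-≤-suc : ∀ {m} (g h : Fin m → Bool) y → (∀ z → z ≢ y → g z ≡ h z) → deg g ≤ suc (deg h)
deg-≤-suc {suc m} g h y agree = begin
  deg g                                    ≡⟨ deg-punchIn g y ⟩
  b2n (g y) + deg (g ∘ punchIn y)          ≡⟨ cong (b2n (g y) +_) (sumFin-cong λ z →
                                                cong b2n (agree (punchIn y z) (punchInᵢ≢i y z))) ⟩
  b2n (g y) + deg (h ∘ punchIn y)          ≤⟨ +-mono-≤ (b2n≤1 (g y)) (m≤n+m _ (b2n (h y))) ⟩
  1 + (b2n (h y) + deg (h ∘ punchIn y))    ≡⟨ cong suc (deg-punchIn h y) ⟨
  suc (deg h)                              ∎
  where open ≤-Reasoning

deg-≤-length : ∀ {m} (g : Fin m → Bool) (L : List (Fin m)) → (∀ y → g y ≡ true → y ∈ L) →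
               deg g ≤ length L
deg-≤-length {m} g [] support = begin
  deg g                   ≡⟨ sumFin-cong absent ⟩
  sumFin {m} (λ _ → 0)    ≡⟨ sumFin-const m 0 ⟩
  m * 0                   ≡⟨ *-zeroʳ m ⟩
  0                       ∎
  where
  open ≤-Reasoning
  absent : ∀ y → b2n (g y) ≡ 0
  absent y with g y in gy
  ... | true  = contradiction (support y gy) λ ()
  ... | false = refl
deg-≤-length {m} g (y ∷ L) support =
  ≤-trans (deg-≤-suc g g′ y agree) (s≤s (deg-≤-length g′ L support′))
  where
  g′ : Fin m → Bool
  g′ z with z ≟ y
  ... | yes _ = false
  ... | no  _ = g z
  agree : ∀ z → z ≢ y → g z ≡ g′ z
  agree z z≢y with z ≟ y
  ... | yes z≡y = contradiction z≡y z≢y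
  ... | no  _   = refl
  support′ : ∀ z → g′ z ≡ true → z ∈ L
  support′ z g′z with z ≟ y
  support′ z () | yes _
  support′ z gz | no z≢y with support z gz
  ... | here z≡y  = contradiction z≡y z≢y
  ... | there z∈L = z∈L

choose-outside : ∀ {m} (g : Fin m → Bool) (L : List (Fin m)) → length L < deg g →
                 ∃[ y ] g y ≡ true × All (y ≢_) L
choose-outside g L L<deg with any? (λ y → (g y ≟ᵇ true) ×-dec ¬? (Any.any? (y ≟_) L))
... | yes (y , gy , y∉L) = y , gy , ¬Any⇒All¬ L y∉L
... | no none = contradiction (deg-≤-length g L covered) (<⇒≱ L<deg)
  where
  covered : ∀ y → g y ≡ true → y ∈ L
  covered y gy = decidable-stable (Any.any? (y ≟_) L) (λ y∉L → none (y , gy , y∉L))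

fresh : ∀ {m} (L : List (Fin m)) → length L < m → ∃[ y ] All (y ≢_) L
fresh L L<m with choose-outside (λ _ → true) L (<-≤-trans L<m (≤-reflexive (sym deg-true)))
... | y , _ , y∉L = y , y∉L

Disjoint : ∀ {m} → (Fin m → Bool) → (Fin m → Bool) → Set
Disjoint g h = ∀ y → g y ≡ true → h y ≡ true → ⊥

deg-disjoint : ∀ {m} (g h : Fin m → Bool) → Disjoint g h → deg g + deg h ≤ m
deg-disjoint {m} g h disjoint = begin
  deg g + deg h                           ≡⟨ sumFin-+ (b2n ∘ g) (b2n ∘ h) ⟨
  sumFin (λ y → b2n (g y) + b2n (h y))    ≤⟨ sumFin-mono atMostOne ⟩
  sumFin {m} (λ _ → 1)                    ≡⟨ deg-true ⟩
  m                                       ∎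
  where
  open ≤-Reasoning
  atMostOne : ∀ y → b2n (g y) + b2n (h y) ≤ 1
  atMostOne y with g y in gy | h y in hy
  ... | true  | true  = ⊥-elim (disjoint y gy hy)
  ... | true  | false = s≤s z≤n
  ... | false | b     = b2n≤1 b

column : ∀ {a b} → BipGraph a b → Fin b → Fin a → Bool
column G j x = G x j

restrict : ∀ {a b a′ b′} → BipGraph a b → (Fin a′ → Fin a) → (Fin b′ → Fin b) → BipGraph a′ b′
restrict G σ τ x y = G (σ x) (τ y)

ContainsPath-restrict : ∀ {a b a′ b′ k} (G : BipGraph a b) {σ : Fin a′ → Fin a} {τ : Fin b′ → Fin b} →
  Injective _≡_ _≡_ σ → Injective _≡_ _≡_ τ → ContainsPath k (restrict G σ τ) → ContainsPath k G
ContainsPath-restrict {a′ = a′} {b′} G {σ} {τ} σ-inj τ-inj (f , f-inj , f-adj) =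
  lift ∘ f , f-inj ∘ lift-inj , λ i j i→j → lift-adj (f i) (f j) (f-adj i j i→j)
  where
  lift : Vertex a′ b′ → Vertex _ _
  lift (inj₁ x) = inj₁ (σ x)
  lift (inj₂ y) = inj₂ (τ y)
  lift-inj : Injective _≡_ _≡_ lift
  lift-inj {inj₁ _} {inj₁ _} eq = cong inj₁ (σ-inj (inj₁-injective eq))
  lift-inj {inj₂ _} {inj₂ _} eq = cong inj₂ (τ-inj (inj₂-injective eq))
  lift-inj {inj₁ _} {inj₂ _} ()
  lift-inj {inj₂ _} {inj₁ _} ()
  lift-adj : ∀ u v → Adj (restrict G σ τ) u v → Adj G (lift u) (lift v)
  lift-adj (inj₁ _) (inj₂ _) e = e
  lift-adj (inj₂ _) (inj₁ _) e = e

deleteRow : ∀ {a b} → BipGraph (suc a) b → Fin (suc a) → BipGraph a b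
deleteRow G i = restrict G (punchIn i) id

deleteColumn : ∀ {a b} → BipGraph a (suc b) → Fin (suc b) → BipGraph a b
deleteColumn G j = restrict G id (punchIn j)

P7Free-deleteRow : ∀ {a b} (G : BipGraph (suc a) b) i → P7Free G → P7Free (deleteRow G i)
P7Free-deleteRow G i free = free ∘ ContainsPath-restrict G (punchIn-injective i _ _) id

P7Free-deleteColumn : ∀ {a b} (G : BipGraph a (suc b)) j → P7Free G → P7Free (deleteColumn G j)
P7Free-deleteColumn G j free = free ∘ ContainsPath-restrict G id (punchIn-injective j _ _)

edges-deleteRow : ∀ {a b} (G : BipGraph (suc a) b) i → edges G ≡ deg (G i) + edges (deleteRow G i)
edges-deleteRow G i = sumFin-punchIn i (deg ∘ G)

edges-deleteColumn : ∀ {a b} (G : BipGraph a (suc b)) j →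
                     edges G ≡ deg (column G j) + edges (deleteColumn G j)
edges-deleteColumn G j = trans (sumFin-cong (λ x → deg-punchIn (G x) j))
                               (sumFin-+ (λ x → b2n (G x j)) (λ x → deg (G x ∘ punchIn j)))

edges≤ : ∀ {a b} (G : BipGraph a b) → edges G ≤ a * b
edges≤ {a} {b} G = ≤-trans (sumFin-mono (deg≤ ∘ G)) (≤-reflexive (sumFin-const a b))

complete : ∀ a b → BipGraph a b
complete a b _ _ = true

edges-complete : ∀ a b → edges (complete a b) ≡ a * b
edges-complete a b = trans (sumFin-cong {a} λ _ → deg-true) (sumFin-const a b)

consecutive : ∀ {k} {P : Fin (suc k) → Fin (suc k) → Set} → (∀ i → P (inject₁ i) (suc i)) →
              ∀ i j → toℕ j ≡ suc (toℕ i) → P i j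
consecutive step zero (suc zero) _ = step zero
consecutive {suc k} {P} step (suc i) (suc j) eq =
  consecutive {P = λ i j → P (suc i) (suc j)} (step ∘ suc) i j (suc-injective eq)
consecutive _ zero    zero          ()
consecutive _ zero    (suc (suc _)) ()
consecutive _ (suc _) zero          ()

mkPath : ∀ {a b k} {G : BipGraph a b} (f : Fin (suc k) → Vertex a b) → Injective _≡_ _≡_ f →
         (∀ i → Adj G (f (inject₁ i)) (f (suc i))) → ContainsPath (suc k) G
mkPath {G = G} f f-inj steps = f , f-inj , consecutive {P = λ i j → Adj G (f i) (f j)} steps

P₇-zigzag : ∀ {a b} (G : BipGraph a b) {v u w : Fin a} {x c d y : Fin b} →
  Unique (v ∷ u ∷ w ∷ []) → Unique (x ∷ c ∷ d ∷ y ∷ []) →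
  G v x ≡ true → G v c ≡ true → G u c ≡ true → G u d ≡ true → G w d ≡ true → G w y ≡ true →
  ContainsPath 7 G
P₇-zigzag G {v} {u} {w} {x} {c} {d} {y}
  ((v≢u ∷ v≢w ∷ []) ∷ (u≢w ∷ []) ∷ [] ∷ [])
  ((x≢c ∷ x≢d ∷ x≢y ∷ []) ∷ (c≢d ∷ c≢y ∷ []) ∷ (d≢y ∷ []) ∷ [] ∷ [])
  vx vc uc ud wd wy = mkPath (lookup path) (lookup-injective path-unique _ _) step
  where
  path : Vec (Vertex _ _) 7
  path = inj₂ x ∷ inj₁ v ∷ inj₂ c ∷ inj₁ u ∷ inj₂ d ∷ inj₁ w ∷ inj₂ y ∷ []
  A : ∀ {s t : Fin _} → s ≢ t → inj₁ s ≢ inj₁ t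
  A s≢t = s≢t ∘ inj₁-injective
  B : ∀ {s t : Fin _} → s ≢ t → inj₂ s ≢ inj₂ t
  B s≢t = s≢t ∘ inj₂-injective
  path-unique : Unique path
  path-unique =
      ((λ ()) ∷ B x≢c ∷ (λ ()) ∷ B x≢d ∷ (λ ()) ∷ B x≢y ∷ [])
    ∷ ((λ ()) ∷ A v≢u ∷ (λ ()) ∷ A v≢w ∷ (λ ()) ∷ [])
    ∷ ((λ ()) ∷ B c≢d ∷ (λ ()) ∷ B c≢y ∷ [])
    ∷ ((λ ()) ∷ A u≢w ∷ (λ ()) ∷ [])
    ∷ ((λ ()) ∷ B d≢y ∷ [])
    ∷ ((λ ()) ∷ [])
    ∷ [] ∷ []
  step : ∀ i → Adj G (lookup path (inject₁ i)) (lookup path (suc i))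
  step zero                                = vx
  step (suc zero)                          = vc
  step (suc (suc zero))                    = uc
  step (suc (suc (suc zero)))              = ud
  step (suc (suc (suc (suc zero))))        = wd
  step (suc (suc (suc (suc (suc zero))))) = wy

A-endpoint : ∀ {a b} {G : BipGraph a b} {u v} → Adj G u v → Fin a
A-endpoint {u = inj₁ x} {inj₂ _} _ = x
A-endpoint {u = inj₂ _} {inj₁ x} _ = x

A-endpoint-≢ : ∀ {a b} {G : BipGraph a b} {u v u′ v′} (e : Adj G u v) (e′ : Adj G u′ v′) →
  u ≢ u′ → u ≢ v′ → v ≢ u′ → v ≢ v′ → A-endpoint e ≢ A-endpoint e′
A-endpoint-≢ {u = inj₁ _} {inj₂ _} {inj₁ _} {inj₂ _} _ _ u≢u′ _ _ _ = u≢u′ ∘ cong inj₁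
A-endpoint-≢ {u = inj₁ _} {inj₂ _} {inj₂ _} {inj₁ _} _ _ _ u≢v′ _ _ = u≢v′ ∘ cong inj₁
A-endpoint-≢ {u = inj₂ _} {inj₁ _} {inj₁ _} {inj₂ _} _ _ _ _ v≢u′ _ = v≢u′ ∘ cong inj₁
A-endpoint-≢ {u = inj₂ _} {inj₁ _} {inj₂ _} {inj₁ _} _ _ _ _ _ v≢v′ = v≢v′ ∘ cong inj₁

Unique⇒length≤ : ∀ {m n} {xs : Vec (Fin m) n} → Unique xs → n ≤ m
Unique⇒length≤ {xs = xs} xs-unique = ≮⇒≥ λ m<n →
  let i , j , i<j , xᵢ≡xⱼ = pigeonhole m<n (lookup xs)
  in <ᶠ-irrefl (lookup-injective xs-unique i j xᵢ≡xⱼ) i<j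

P7Free-two-rows : ∀ {b} (G : BipGraph 2 b) → P7Free G
P7Free-two-rows G (f , f-inj , f-adj) = 1+n≰n (Unique⇒length≤ ends-unique)
  where
  f≢ : ∀ {i j} → i ≢ j → f i ≢ f j
  f≢ i≢j = i≢j ∘ f-inj
  e₀₁ = f-adj (# 0) (# 1) refl
  e₂₃ = f-adj (# 2) (# 3) refl
  e₄₅ = f-adj (# 4) (# 5) refl
  ends-unique : Unique (A-endpoint e₀₁ ∷ A-endpoint e₂₃ ∷ A-endpoint e₄₅ ∷ [])
  ends-unique =
      ( A-endpoint-≢ e₀₁ e₂₃ (f≢ λ ()) (f≢ λ ()) (f≢ λ ()) (f≢ λ ())
      ∷ A-endpoint-≢ e₀₁ e₄₅ (f≢ λ ()) (f≢ λ ()) (f≢ λ ()) (f≢ λ ())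
      ∷ [])
    ∷ (A-endpoint-≢ e₂₃ e₄₅ (f≢ λ ()) (f≢ λ ()) (f≢ λ ()) (f≢ λ ()) ∷ [])
    ∷ [] ∷ []

extend-P₅ : ∀ {a b} (G : BipGraph a b) {v u w : Fin a} {c d : Fin b} →
  Unique (v ∷ u ∷ w ∷ []) → c ≢ d → 3 < deg (G v) → 3 < deg (G w) →
  G v c ≡ true → G u c ≡ true → G u d ≡ true → G w d ≡ true → ContainsPath 7 G
extend-P₅ G {v} {w = w} {c} {d} vuw-unique c≢d 3<deg-v 3<deg-w vc uc ud wd
  with choose-outside (G v) (c ∷ d ∷ []) (<⇒≤ 3<deg-v)
... | x , vx , (x≢c ∷ x≢d ∷ []) with choose-outside (G w) (c ∷ d ∷ x ∷ []) 3<deg-w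
... | y , wy , (y≢c ∷ y≢d ∷ y≢x ∷ []) = P₇-zigzag G vuw-unique xcdy-unique vx vc uc ud wd wy
  where
  xcdy-unique : Unique (x ∷ c ∷ d ∷ y ∷ [])
  xcdy-unique = (x≢c ∷ x≢d ∷ ≢-sym y≢x ∷ []) ∷ (c≢d ∷ ≢-sym y≢c ∷ []) ∷ (≢-sym y≢d ∷ []) ∷ [] ∷ []

complete-rows-P₇ : ∀ {a b} (G : BipGraph a b) {j₁ j₀ i : Fin a} → Unique (j₁ ∷ j₀ ∷ i ∷ []) →
  (∀ y → G j₀ y ≡ true) → (∀ y → G j₁ y ≡ true) → 1 < deg (G i) → 3 < b → ContainsPath 7 G
complete-rows-P₇ G {i = i} rows-unique j₀-full j₁-full 1<deg-i 3<b
  with choose-outside (G i) [] (<-trans z<s 1<deg-i)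
... | c , ic , [] with choose-outside (G i) (c ∷ []) 1<deg-i
... | y , iy , (y≢c ∷ []) with fresh (c ∷ y ∷ []) (<-trans (n<1+n 2) 3<b)
... | d , (d≢c ∷ d≢y ∷ []) with fresh (c ∷ y ∷ d ∷ []) 3<b
... | x , (x≢c ∷ x≢y ∷ x≢d ∷ []) =
  P₇-zigzag G rows-unique xdcy-unique (j₁-full x) (j₁-full d) (j₀-full d) (j₀-full c) ic iy
  where
  xdcy-unique : Unique (x ∷ d ∷ c ∷ y ∷ [])
  xdcy-unique = (x≢d ∷ x≢c ∷ x≢y ∷ []) ∷ (d≢c ∷ d≢y ∷ []) ∷ (≢-sym y≢c ∷ []) ∷ [] ∷ []

disjoint-rows : ∀ {a b} (G : BipGraph a b) → P7Free G → 3 ≤ a →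
  (∀ i → 3 < deg (G i)) → (∀ j → 1 < deg (column G j)) → ∃₂ λ i i′ → Disjoint (G i) (G i′)
disjoint-rows {suc a} G free 3≤a 3<deg-row 1<deg-column
  with choose-outside (G zero) [] (≤-<-trans z≤n (3<deg-row zero))
... | b , a₁b , [] with choose-outside (column G b) (zero ∷ []) (1<deg-column b)
... | a₂ , a₂b , (a₂≢a₁ ∷ []) with fresh (zero ∷ a₂ ∷ []) 3≤a
... | a₃ , (a₃≢a₁ ∷ a₃≢a₂ ∷ []) = zero , a₃ , disjoint
  where
  -- A common neighbour c ≢ b closes the P₅ a₂ b a₁ c a₃; the common neighbour b is ruled out by
  -- rerouting through another neighbour c′ of a₁ and another neighbour a₄ of c′.
  only-b : ∀ c → G zero c ≡ true → G a₃ c ≡ true → c ≡ b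
  only-b c a₁c a₃c with c ≟ b
  ... | yes c≡b = c≡b
  ... | no  c≢b = ⊥-elim (free (extend-P₅ G a₂a₁a₃-unique (≢-sym c≢b) (3<deg-row a₂) (3<deg-row a₃)
                                            a₂b a₁b a₁c a₃c))
    where
    a₂a₁a₃-unique : Unique (a₂ ∷ zero ∷ a₃ ∷ [])
    a₂a₁a₃-unique = (a₂≢a₁ ∷ ≢-sym a₃≢a₂ ∷ []) ∷ (≢-sym a₃≢a₁ ∷ []) ∷ [] ∷ []
  disjoint : Disjoint (G zero) (G a₃)
  disjoint c a₁c a₃c with only-b c a₁c a₃c
  ... | refl with choose-outside (G zero) (b ∷ []) (≤-<-trans (s≤s z≤n) (3<deg-row zero))
  ... | c′ , a₁c′ , (c′≢b ∷ []) with choose-outside (column G c′) (zero ∷ []) (1<deg-column c′)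
  ... | a₄ , a₄c′ , (a₄≢a₁ ∷ []) with a₄ ≟ a₃
  ... | yes refl = c′≢b (only-b c′ a₁c′ a₄c′)
  ... | no  a₄≢a₃ = free (extend-P₅ G a₃a₁a₄-unique (≢-sym c′≢b) (3<deg-row a₃) (3<deg-row a₄)
                                     a₃c a₁c a₁c′ a₄c′)
    where
    a₃a₁a₄-unique : Unique (a₃ ∷ zero ∷ a₄ ∷ [])
    a₃a₁a₄-unique = (a₃≢a₁ ∷ ≢-sym a₄≢a₃ ∷ []) ∷ (≢-sym a₄≢a₁ ∷ []) ∷ [] ∷ []

three-rows-arith : ∀ {p b d d₀ d₁} → d ≤ p → d₀ ≤ b → d₁ ≤ b → b ≤ 2 * p →
  d < p ⊎ d₀ < b ⊎ d₁ < b ⊎ b < 2 * p → d + (d₀ + d₁) < p * 3 + b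
three-rows-arith {p} {b} {d} {d₀} {d₁} d≤p d₀≤b d₁≤b b≤2p slack =
  <-≤-trans (with-slack slack) (≤-reflexive (rearrange p b))
  where
  rearrange : ∀ p b → p + (b + 2 * p) ≡ p * 3 + b
  rearrange = solve-∀
  with-slack : d < p ⊎ d₀ < b ⊎ d₁ < b ⊎ b < 2 * p → d + (d₀ + d₁) < p + (b + 2 * p)
  with-slack (inj₁ d<p) = +-mono-<-≤ d<p (+-mono-≤ d₀≤b (≤-trans d₁≤b b≤2p))
  with-slack (inj₂ (inj₁ d₀<b)) = +-mono-≤-< d≤p (+-mono-<-≤ d₀<b (≤-trans d₁≤b b≤2p))
  with-slack (inj₂ (inj₂ (inj₁ d₁<b))) = +-mono-≤-< d≤p (+-mono-≤-< d₀≤b (<-≤-trans d₁<b b≤2p))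
  with-slack (inj₂ (inj₂ (inj₂ b<2p))) = +-mono-≤-< d≤p (+-mono-≤-< d₀≤b (≤-<-trans d₁≤b b<2p))

edges-deleteColumn-< : ∀ {a b N} (G : BipGraph a (suc b)) j → deg (column G j) ≤ 1 →
  edges (deleteColumn G j) < N + b → edges G < N + suc b
edges-deleteColumn-< {b = b} {N} G j deg≤1 bound = begin-strict
  edges G                                       ≡⟨ edges-deleteColumn G j ⟩
  deg (column G j) + edges (deleteColumn G j)   <⟨ +-mono-≤-< deg≤1 bound ⟩
  suc (N + b)                                   ≡⟨ +-suc N b ⟨
  N + suc b                                     ∎
  where open ≤-Reasoning

edges-deleteRow-< : ∀ {a b p} (G : BipGraph (suc a) b) i → deg (G i) ≤ p →
  edges (deleteRow G i) < p * a + b → edges G < p * suc a + b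
edges-deleteRow-< {a} {b} {p} G i deg≤p bound = begin-strict
  edges G                               ≡⟨ edges-deleteRow G i ⟩
  deg (G i) + edges (deleteRow G i)     <⟨ +-mono-≤-< deg≤p bound ⟩
  p + (p * a + b)                       ≡⟨ +-assoc p (p * a) b ⟨
  p + p * a + b                         ≡⟨ cong (_+ b) (*-suc p a) ⟨
  p * suc a + b                         ∎
  where open ≤-Reasoning

module _ {p : ℕ} (3≤p : 3 ≤ p) where

  high-degrees-impossible : ∀ {a b} (G : BipGraph a b) → P7Free G → 3 ≤ a → b ≤ 2 * p →
    (∀ i → p < deg (G i)) → (∀ j → 1 < deg (column G j)) → ⊥
  high-degrees-impossible G free 3≤a b≤2p p<deg-row 1<deg-column
    with disjoint-rows G free 3≤a (λ i → ≤-<-trans 3≤p (p<deg-row i)) 1<deg-column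
  ... | i , i′ , disjoint = <⇒≱ 2p<degs (≤-trans (deg-disjoint (G i) (G i′) disjoint) b≤2p)
    where
    open ≤-Reasoning
    2p<degs : 2 * p < deg (G i) + deg (G i′)
    2p<degs = begin-strict
      p + (p + 0)              ≡⟨ cong (p +_) (+-identityʳ p) ⟩
      p + p                    <⟨ +-mono-< (p<deg-row i) (p<deg-row i′) ⟩
      deg (G i) + deg (G i′)   ∎

  low-degree-vertex : ∀ {a b} (G : BipGraph a b) → P7Free G → 3 ≤ a → b ≤ 2 * p →
    (∃[ j ] deg (column G j) ≤ 1) ⊎ (∃[ i ] deg (G i) ≤ p)
  low-degree-vertex G free 3≤a b≤2p
    with any? (λ j → deg (column G j) ≤? 1) | any? (λ i → deg (G i) ≤? p)
  ... | yes low-column    | _           = inj₁ low-column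
  ... | no  _             | yes low-row = inj₂ low-row
  ... | no  no-low-column | no no-low-row = ⊥-elim (high-degrees-impossible G free 3≤a b≤2p
          (λ i → ≰⇒> (no-low-row ∘ (i ,_))) (λ j → ≰⇒> (no-low-column ∘ (j ,_))))

  P7Free-three-rows-edges< : ∀ {b} (G : BipGraph 3 b) → P7Free G → b ≤ 2 * p →
    ∀ i → deg (G i) ≤ p → edges G < p * 3 + b
  P7Free-three-rows-edges< {b} G free b≤2p i deg≤p = begin-strict
    edges G                                       ≡⟨ edges-deleteRow G i ⟩
    deg (G i) + (deg (G j₀) + (deg (G j₁) + 0))   ≡⟨ cong (λ e → deg (G i) + (deg (G j₀) + e))
                                                          (+-identityʳ (deg (G j₁))) ⟩
    deg (G i) + (deg (G j₀) + deg (G j₁))         <⟨ three-rows-arith deg≤p (deg≤ (G j₀)) (deg≤ (G j₁))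
                                                                      b≤2p slack ⟩
    p * 3 + b                                     ∎
    where
    open ≤-Reasoning
    j₀ j₁ : Fin 3
    j₀ = punchIn i zero
    j₁ = punchIn i (suc zero)
    rows-unique : Unique (j₁ ∷ j₀ ∷ i ∷ [])
    rows-unique =
      ((λ ()) ∘ punchIn-injective i _ _ ∷ punchInᵢ≢i i _ ∷ []) ∷ (punchInᵢ≢i i _ ∷ []) ∷ [] ∷ []
    slack : deg (G i) < p ⊎ deg (G j₀) < b ⊎ deg (G j₁) < b ⊎ b < 2 * p
    slack with deg (G i) <? p | deg (G j₀) <? b | deg (G j₁) <? b | b <? 2 * p
    ... | yes d<p | _        | _        | _        = inj₁ d<p
    ... | no _    | yes d₀<b | _        | _        = inj₂ (inj₁ d₀<b)
    ... | no _    | no _     | yes d₁<b | _        = inj₂ (inj₂ (inj₁ d₁<b))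
    ... | no _    | no _     | no _     | yes b<2p = inj₂ (inj₂ (inj₂ b<2p))
    ... | no d≮p  | no d₀≮b  | no d₁≮b  | no b≮2p  = ⊥-elim (free (complete-rows-P₇ G rows-unique
          (deg-full (G j₀) (≮⇒≥ d₀≮b)) (deg-full (G j₁) (≮⇒≥ d₁≮b))
          (≤-trans (s≤s (s≤s z≤n)) (≤-trans 3≤p (≮⇒≥ d≮p)))
          (≤-trans (s≤s (s≤s (s≤s (s≤s z≤n)))) (≤-trans (*-monoʳ-≤ 2 3≤p) (≮⇒≥ b≮2p)))))

  edges<-no-columns : ∀ {a} (G : BipGraph (suc a) 0) → edges G < p * suc a + 0
  edges<-no-columns {a} G = begin-strict
    edges G          ≤⟨ edges≤ G ⟩
    suc a * 0        ≡⟨ *-zeroʳ (suc a) ⟩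
    0                <⟨ ≤-trans (s≤s z≤n) 3≤p ⟩
    p                ≤⟨ m≤m*n p (suc a) ⟩
    p * suc a        ≤⟨ m≤m+n (p * suc a) 0 ⟩
    p * suc a + 0    ∎
    where open ≤-Reasoning

  P7Free-edges< : ∀ k {b} (G : BipGraph (3 + k) b) → P7Free G → b ≤ 2 * p → edges G < p * (3 + k) + b
  P7Free-edges< k {zero} G _ _ = edges<-no-columns G
  P7Free-edges< k {suc b} G free b≤2p with low-degree-vertex G free (s≤s (s≤s (s≤s z≤n))) b≤2p
  ... | inj₁ (j , deg≤1) = edges-deleteColumn-< G j deg≤1
    (P7Free-edges< k (deleteColumn G j) (P7Free-deleteColumn G j free) (≤-trans (n≤1+n b) b≤2p))
  P7Free-edges< zero    {suc b} G free b≤2p | inj₂ (i , deg≤p) =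
    P7Free-three-rows-edges< G free b≤2p i deg≤p
  P7Free-edges< (suc k) {suc b} G free b≤2p | inj₂ (i , deg≤p) = edges-deleteRow-< G i deg≤p
    (P7Free-edges< k (deleteRow G i) (P7Free-deleteRow G i free) b≤2p)

  P7Free-edges≤ : ∀ {n b} (G : BipGraph n b) → P7Free G → b ≤ 2 * p → edges G ≤ p * n + b
  P7Free-edges≤ {zero}  G _ _ = z≤n
  P7Free-edges≤ {1} {b} G _ _ = begin
    edges G      ≤⟨ edges≤ G ⟩
    1 * b        ≡⟨ *-identityˡ b ⟩
    b            ≤⟨ m≤n+m b (p * 1) ⟩
    p * 1 + b    ∎
    where open ≤-Reasoning
  P7Free-edges≤ {2} {b} G _ b≤2p = begin
    edges G      ≤⟨ edges≤ G ⟩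
    b + (b + 0)  ≡⟨ cong (b +_) (+-identityʳ b) ⟩
    b + b        ≤⟨ +-monoˡ-≤ b b≤2p ⟩
    2 * p + b    ≡⟨ cong (_+ b) (*-comm 2 p) ⟩
    p * 2 + b    ∎
    where open ≤-Reasoning
  P7Free-edges≤ {suc (suc (suc k))} G free b≤2p = <⇒≤ (P7Free-edges< k G free b≤2p)

  P7Free-edges≡ : ∀ {n b} (G : BipGraph n b) → P7Free G → b ≤ 2 * p → edges G ≡ p * n + b →
    (n ≡ 0 × b ≡ 0) ⊎ (b ≡ 2 * p × n ≡ 2)
  P7Free-edges≡ {zero} {b} G _ _ tight = inj₁ (refl , trans (cong (_+ b) (sym (*-zeroʳ p))) (sym tight))
  P7Free-edges≡ {1} {b} G _ _ tight =
    ⊥-elim (<⇒≱ (≤-trans (s≤s z≤n) 3≤p) (≤-trans (m≤m*n p 1) (+-cancelʳ-≤ b (p * 1) 0 p+b≤b)))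
    where
    open ≤-Reasoning
    p+b≤b : p * 1 + b ≤ b
    p+b≤b = begin
      p * 1 + b    ≡⟨ tight ⟨
      edges G      ≤⟨ edges≤ G ⟩
      1 * b        ≡⟨ *-identityˡ b ⟩
      b            ∎
  P7Free-edges≡ {2} {b} G _ b≤2p tight = inj₂ (≤-antisym b≤2p (+-cancelʳ-≤ b (2 * p) b 2p+b≤b+b) , refl)
    where
    open ≤-Reasoning
    2p+b≤b+b : 2 * p + b ≤ b + b
    2p+b≤b+b = begin
      2 * p + b    ≡⟨ cong (_+ b) (*-comm 2 p) ⟩
      p * 2 + b    ≡⟨ tight ⟨
      edges G      ≤⟨ edges≤ G ⟩
      b + (b + 0)  ≡⟨ cong (b +_) (+-identityʳ b) ⟩
      b + b        ∎
  P7Free-edges≡ {suc (suc (suc k))} G free b≤2p tight =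
    ⊥-elim (<-irrefl tight (P7Free-edges< k G free b≤2p))

lemma2p1 : (p n₁ m₁ : ℕ) → 3 ≤ p → m₁ ≤ 2 * p →
    ((G : BipGraph n₁ m₁) → P7Free G → edges G ≤ p * n₁ + m₁)
    × ((Σ (BipGraph n₁ m₁) λ G → P7Free G × edges G ≡ p * n₁ + m₁)
        ⇔ ((n₁ ≡ 0 × m₁ ≡ 0) ⊎ (m₁ ≡ 2 * p × n₁ ≡ 2)))
lemma2p1 p n₁ m₁ 3≤p m₁≤2p =
    (λ G free → P7Free-edges≤ 3≤p G free m₁≤2p)
  , mk⇔ (λ (G , free , tight) → P7Free-edges≡ 3≤p G free m₁≤2p tight) extremal
  where
  extremal : (n₁ ≡ 0 × m₁ ≡ 0) ⊎ (m₁ ≡ 2 * p × n₁ ≡ 2) →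
             Σ (BipGraph n₁ m₁) λ G → P7Free G × edges G ≡ p * n₁ + m₁
  extremal (inj₁ (refl , refl)) =
    complete 0 0 , (λ (f , _) → [ (λ ()) , (λ ()) ]′ (f zero)) ,
    sym (trans (+-identityʳ (p * 0)) (*-zeroʳ p))
  extremal (inj₂ (refl , refl)) =
    complete 2 (2 * p) , P7Free-two-rows _ , (begin
      edges (complete 2 (2 * p))   ≡⟨ edges-complete 2 (2 * p) ⟩
      2 * p + (2 * p + 0)          ≡⟨ cong (2 * p +_) (+-identityʳ (2 * p)) ⟩
      2 * p + 2 * p                ≡⟨ cong (_+ 2 * p) (*-comm 2 p) ⟩
      p * 2 + 2 * p                ∎)
    where open ≡-Reasoning
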